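{- Let $\tau:$ SYNCSIMPLE $\to$ LOCKSIMPLE$_{k,IS}$ be a correct translation where $k \geq 2$. Then there is some $i$, such that $\tau(!)$ has a blocking subsequence of the form $RP_i$, or $P_iRP_i$, where $R$ does not contain $P_i,T_i$. The same holds for $\tau(?)$.
   Context: SYNCSIMPLE: subprocesses $U ::= \checkmark \mid 0 \mid\ !U \mid\ ?U$; processes are parallel compositions (multisets) of subprocesses; reduction $!U_1 \mid ?U_2 \mid P \to U_1 \mid U_2 \mid P$; successful = has a parallel component $\checkmark$; may-convergent = reduces to a successful process; must-convergent = every reduct is may-convergent. LOCKSIMPLE$_{k,IS}$: $k$ locks, each full ($\blacksquare$) or empty ($\Box$), initial store $IS$; subprocesses $U ::= 0 \mid \checkmark \mid P_iU \mid T_iU$; $P_i$ on empty lock $i$ fills it, on a full lock blocks; $T_i$ never blocks and empties lock $i$. Convergence evaluated from $(P,IS)$. $\tau$ is compositional ($\tau(0)=0$, $\tau(\checkmark)=\checkmark$, $\tau$ commutes with parallel composition, $\tau(!U)=\tau(!)\tau(U)$, $\tau(?U)=\tau(?)\tau(U)$); correct = preserve and reflect may- and must-convergence. Blocking prefix of a sequence $S$ (executed alone from $IS$): either $R_1P_iR_2P_i$ with $R_2$ free of $P_i,T_i$ and execution deadlocking exactly before the last $P_i$, or $R_1P_i$ with $R_1$ free of $P_i,T_i$ and execution deadlocking exactly before this $P_i$; the suffix $P_iR_2P_i$ resp. $R_1P_i$ is called a blocking subsequence. -}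

module Defs where

open import Data.Nat using (ℕ)
open import Data.Fin using (Fin)
open import Data.Bool using (Bool; true; false; if_then_else_)
open import Data.Vec using (Vec; lookup; _[_]≔_)
open import Data.List using (List; []; _∷_; map; _++_)
open import Data.List.Membership.Propositional using (_∈_)
open import Data.List.Relation.Unary.All using (All)
open import Data.List.Relation.Binary.Permutation.Propositional using (_↭_)
open import Data.Maybe using (Maybe; just; nothing)
open import Data.Product using (Σ; ∃; ∃-syntax; _×_; _,_)
open import Data.Sum using (_⊎_)
open import Relation.Binary.PropositionalEquality using (_≡_; _≢_)
open import Relation.Binary.Construct.Closure.ReflexiveTransitive using (Star)
open import Function.Bundles using (_⇔_)

-- subprocesses  U ::= ✓ | 0 | !U | ?U
data SSub : Set where
  tick : SSub
  nil  : SSub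
  out  : SSub → SSub
  inp  : SSub → SSub

-- processes: parallel compositions = multisets of subprocesses
-- (lists, taken up to permutation in the reduction relation)
SProc : Set
SProc = List SSub

data _⟶S_ : SProc → SProc → Set where
  sync : ∀ {P U₁ U₂ R} → P ↭ (out U₁ ∷ inp U₂ ∷ R) → P ⟶S (U₁ ∷ U₂ ∷ R)

_⟶S*_ : SProc → SProc → Set
_⟶S*_ = Star _⟶S_

SuccessfulS : SProc → Set
SuccessfulS P = tick ∈ P

MayS : SProc → Set
MayS P = ∃[ Q ] (P ⟶S* Q × SuccessfulS Q)

MustS : SProc → Set
MustS P = ∀ Q → P ⟶S* Q → MayS Q

-- lock actions P_i (put) and T_i (take)
data Act (k : ℕ) : Set where
  put  : Fin k → Act k
  take : Fin k → Act k

lockOf : ∀ {k} → Act k → Fin k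
lockOf (put i)  = i
lockOf (take i) = i

data LSub (k : ℕ) : Set where
  nil  : LSub k
  tick : LSub k
  putU  : Fin k → LSub k → LSub k
  takeU : Fin k → LSub k → LSub k

prefix : ∀ {k} → List (Act k) → LSub k → LSub k
prefix []            U = U
prefix (put i ∷ w)  U = putU i (prefix w U)
prefix (take i ∷ w) U = takeU i (prefix w U)

LProc : ℕ → Set
LProc k = List (LSub k)

-- lock store: true = full (■), false = empty (□)
Store : ℕ → Set
Store k = Vec Bool k

LState : ℕ → Set
LState k = LProc k × Store k

data _⟶L_ {k : ℕ} : LState k → LState k → Set where
  stepP : ∀ {P i U R s} → P ↭ (putU i U ∷ R) → lookup s i ≡ false →
          (P , s) ⟶L (U ∷ R , s [ i ]≔ true)
  stepT : ∀ {P i U R s} → P ↭ (takeU i U ∷ R) →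
          (P , s) ⟶L (U ∷ R , s [ i ]≔ false)

_⟶L*_ : ∀ {k} → LState k → LState k → Set
_⟶L*_ = Star _⟶L_

SuccessfulL : ∀ {k} → LState k → Set
SuccessfulL (P , s) = tick ∈ P

MayL : ∀ {k} → LState k → Set
MayL {k} c = ∃[ d ] (c ⟶L* d × SuccessfulL d)

MustL : ∀ {k} → LState k → Set
MustL {k} c = ∀ (d : LState k) → c ⟶L* d → MayL d

-- compositional translations: determined by the words τ(!) and τ(?)

τSub : ∀ {k} → (τ! τ? : List (Act k)) → SSub → LSub k
τSub τ! τ? tick    = tick
τSub τ! τ? nil     = nil
τSub τ! τ? (out U) = prefix τ! (τSub τ! τ? U)
τSub τ! τ? (inp U) = prefix τ? (τSub τ! τ? U)

τProc : ∀ {k} → (τ! τ? : List (Act k)) → SProc → LProc k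
τProc τ! τ? P = map (τSub τ! τ?) P

Correct : ∀ {k} → Store k → (τ! τ? : List (Act k)) → Set
Correct IS τ! τ? =
  ∀ (P : SProc) →
    (MayS P ⇔ MayL (τProc τ! τ? P , IS)) ×
    (MustS P ⇔ MustL (τProc τ! τ? P , IS))

-- executing a sequence alone from a store: nothing = deadlock

exec : ∀ {k} → Store k → List (Act k) → Maybe (Store k)
exec s []            = just s
exec s (put i ∷ w)  = if lookup s i then nothing else exec (s [ i ]≔ true) w
exec s (take i ∷ w) = exec (s [ i ]≔ false) w

FreeOf : ∀ {k} → Fin k → List (Act k) → Set
FreeOf i R = All (λ a → lockOf a ≢ i) R

-- executing the sequence u alone from IS deadlocks exactly before a
-- following P_i: u runs without blocking and then lock i is full
DeadlocksBefore : ∀ {k} → Store k → List (Act k) → Fin k → Set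
DeadlocksBefore IS u i = ∃[ s ] (exec IS u ≡ just s × lookup s i ≡ true)

-- S has a blocking subsequence R P_i (blocking prefix R P_i, R free of P_i,T_i)
-- or P_i R P_i (blocking prefix R₁ P_i R P_i, R free of P_i,T_i)
HasBlockingSubseq : ∀ {k} → Store k → List (Act k) → Fin k → Set
HasBlockingSubseq IS S i =
  (∃[ R ] ∃[ rest ] (S ≡ R ++ put i ∷ rest × FreeOf i R × DeadlocksBefore IS R i))
  ⊎
  (∃[ R₁ ] ∃[ R ] ∃[ rest ]
     (S ≡ R₁ ++ put i ∷ R ++ put i ∷ rest × FreeOf i R ×
      DeadlocksBefore IS (R₁ ++ put i ∷ R) i))

-- A correct translation must preserve the failure of may-convergence of the
-- stuck SYNCSIMPLE process !✓ (resp. ?✓), so τ(!)✓ run alone from IS never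
-- reaches ✓. As τ(!)✓ can only execute its own prefix, this means that
-- executing τ(!) from IS deadlocks at some P_i on a full lock i. Looking back
-- from that point for the last action on lock i: either there is none, and the
-- prefix read so far is a blocking subsequence R P_i, or it is a P_i (a T_i
-- would have left the lock empty), and P_i R P_i is blocking.
module Submission where

open import Defs
open import Data.Nat using (ℕ; _≤_)
open import Data.Fin using (Fin; _≟_)
open import Data.Bool using (Bool; true; false)
open import Data.List using (List; []; _∷_; _++_; [_])
open import Data.List.Properties using (++-assoc)
open import Data.List.Relation.Unary.All using ([]; _∷_)
open import Data.List.Relation.Unary.Any using (here)
open import Data.List.Relation.Binary.Permutation.Propositional using (↭-refl)
open import Data.List.Relation.Binary.Permutation.Propositional.Properties using (↭-length)
open import Data.Maybe using (just; nothing)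
open import Data.Vec using (lookup; _[_]≔_)
open import Data.Vec.Properties using (lookup∘update; lookup∘update′)
open import Data.Product using (_×_; ∃-syntax; _,_; proj₁)
open import Data.Sum using (_⊎_; inj₁; inj₂)
open import Data.Empty using (⊥-elim)
open import Relation.Nullary using (¬_; yes; no)
open import Relation.Binary.PropositionalEquality using (_≡_; _≢_; refl; sym; trans)
open import Relation.Binary.Construct.Closure.ReflexiveTransitive using (ε; _◅_)
open import Function using (_∘_)
open import Function.Bundles using (Equivalence)

singleton-¬MayS : ∀ {U} → U ≢ tick → ¬ MayS [ U ]
singleton-¬MayS U≢tick (_ , ε , here U≡tick) = U≢tick (sym U≡tick)
singleton-¬MayS U≢tick (_ , sync ρ ◅ _ , _) with () ← ↭-length ρ

exec⇒⟶L* : ∀ {k} {s s′ : Store k} (w : List (Act k)) {U : LSub k} →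
  exec s w ≡ just s′ → ([ prefix w U ] , s) ⟶L* ([ U ] , s′)
exec⇒⟶L* []           refl = ε
exec⇒⟶L* {s = s} (put i ∷ w) run with lookup s i in free
... | false = stepP ↭-refl free ◅ exec⇒⟶L* w run
exec⇒⟶L* (take i ∷ w) run = stepT ↭-refl ◅ exec⇒⟶L* w run

exec≡nothing⇒blockedPut : ∀ {k} (s : Store k) (w : List (Act k)) →
  exec s w ≡ nothing →
  ∃[ A ] ∃[ i ] ∃[ rest ] (w ≡ A ++ put i ∷ rest × DeadlocksBefore s A i)
exec≡nothing⇒blockedPut s (put i ∷ w) stuck with lookup s i in full
... | true = [] , i , w , refl , s , refl , full
... | false with exec≡nothing⇒blockedPut _ w stuck
...   | A , j , rest , refl , s′ , run , full′ =
        put i ∷ A , j , rest , refl , s′ , runFromS , full′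
  where
    runFromS : exec s (put i ∷ A) ≡ just s′
    runFromS rewrite full = run
exec≡nothing⇒blockedPut s (take i ∷ w) stuck
  with exec≡nothing⇒blockedPut _ w stuck
... | A , j , rest , refl , blocked = take i ∷ A , j , rest , refl , blocked

exec-put-inv : ∀ {k} (s : Store k) {j} (A : List (Act k)) {s′} →
  exec s (put j ∷ A) ≡ just s′ → exec (s [ j ]≔ true) A ≡ just s′
exec-put-inv s {j} A run with lookup s j
exec-put-inv s A () | true
... | false = run

full-before-update : ∀ {k} {i j : Fin k} (s : Store k) {b : Bool} → j ≢ i →
  lookup (s [ j ]≔ b) i ≡ true → lookup s i ≡ true
full-before-update s {b} j≢i = trans (sym (lookup∘update′ (λ i≡j → j≢i (sym i≡j)) s b))

full-after-exec : ∀ {k} (i : Fin k) (s : Store k) (A : List (Act k)) →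
  DeadlocksBefore s A i →
  (FreeOf i A × lookup s i ≡ true) ⊎
  (∃[ B ] ∃[ R ] (A ≡ B ++ put i ∷ R × FreeOf i R))
full-after-exec i s [] (_ , refl , full) = inj₁ ([] , full)
full-after-exec i s (put j ∷ A) (s′ , run , full)
  with full-after-exec i (s [ j ]≔ true) A (s′ , exec-put-inv s A run , full)
... | inj₂ (B , R , refl , R-free) = inj₂ (put j ∷ B , R , refl , R-free)
... | inj₁ (A-free , full₀) with j ≟ i
...   | yes refl = inj₂ ([] , A , refl , A-free)
...   | no j≢i   = inj₁ (j≢i ∷ A-free , full-before-update s j≢i full₀)
full-after-exec i s (take j ∷ A) (s′ , run , full)
  with full-after-exec i (s [ j ]≔ false) A (s′ , run , full)
... | inj₂ (B , R , refl , R-free) = inj₂ (take j ∷ B , R , refl , R-free)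
... | inj₁ (A-free , full₀) with j ≟ i
...   | yes refl with () ← trans (sym (lookup∘update i s false)) full₀
...   | no j≢i   = inj₁ (j≢i ∷ A-free , full-before-update s j≢i full₀)

¬MayL⇒blockingSubseq : ∀ {k} (IS : Store k) (w : List (Act k)) →
  ¬ MayL ([ prefix w tick ] , IS) → ∃[ i ] HasBlockingSubseq IS w i
¬MayL⇒blockingSubseq IS w ¬may with exec IS w in run
... | just s  = ⊥-elim (¬may (_ , exec⇒⟶L* w run , here refl))
... | nothing with exec≡nothing⇒blockedPut IS w run
...   | A , i , rest , refl , blocked with full-after-exec i IS A blocked
...     | inj₁ (A-free , _) = i , inj₁ (A , rest , refl , A-free , blocked)
...     | inj₂ (B , R , refl , R-free) =
          i , inj₂ (B , R , rest , ++-assoc B (put i ∷ R) (put i ∷ rest) , R-free , blocked)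

lemma4p4 : ∀ (k : ℕ) → 2 ≤ k → (IS : Store k) (τ! τ? : List (Act k)) →
    Correct IS τ! τ? →
    (∃[ i ] HasBlockingSubseq IS τ! i) × (∃[ i ] HasBlockingSubseq IS τ? i)
lemma4p4 k _ IS τ! τ? correct =
  ¬MayL⇒blockingSubseq IS τ! (stuck (out tick) λ ()) ,
  ¬MayL⇒blockingSubseq IS τ? (stuck (inp tick) λ ())
  where
    stuck : ∀ U → U ≢ tick → ¬ MayL (τProc τ! τ? [ U ] , IS)
    stuck U U≢tick = singleton-¬MayS U≢tick ∘ Equivalence.from (proj₁ (correct [ U ]))
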